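{- The number of realizations of $\bm h_1(n)$ is $\Theta\!\left(\left(\frac{3+\sqrt5}{2}\right)^n\right)$ as $n\to\infty$.
   Context: For $n\ge 1$, let $A_n=\{a_1,\dots,a_n\}$ and $B_n=\{b_1,\dots,b_n\}$ be the colour classes, and let $\bm h_1(n)$ be the bipartite degree sequence with $\bm h_1(n)(a_i)=n+1-i$ and $\bm h_1(n)(b_i)=i$ for all $i$, except that $\bm h_1(n)(a_1)=n-1$ and $\bm h_1(n)(b_n)=n-1$ (i.e.\ $\bm h_0(n)-\mathbb{1}_{a_1}-\mathbb{1}_{b_n}$ where $\bm h_0(n)(a_i)=n+1-i$, $\bm h_0(n)(b_i)=i$). A realization is a bipartite graph with colour classes $A_n,B_n$ (all edges between $A_n$ and $B_n$, labelled vertices) having this degree sequence. -}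

module Defs where

open import Data.Nat using (ℕ; zero; suc; _+_; _*_; _∸_)
open import Data.Nat.Properties using (_≟_)
open import Data.Bool using (Bool; true; false; if_then_else_)
open import Data.Fin using (Fin; toℕ)
open import Data.Vec using (Vec; []; _∷_; tabulate; transpose)
import Data.Vec as V
open import Data.Vec.Properties using (≡-dec)
open import Data.List using (List; []; _∷_; length; filter; cartesianProductWith)
open import Relation.Binary.PropositionalEquality using (_≡_)
open import Data.Product using (_×_)
open import Relation.Nullary using (Dec; yes; no)
open import Relation.Nullary.Decidable using (_×-dec_)

-- A bipartite graph with colour classes A_n = {a_1..a_n}, B_n = {b_1..b_n}
-- (labelled vertices) is its biadjacency matrix: row i (0-indexed) is
-- a_{i+1}, column j (0-indexed) is b_{j+1}; entry true iff a_{i+1} b_{j+1}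
-- is an edge.
BipGraph : ℕ → Set
BipGraph n = Vec (Vec Bool n) n

countTrue : ∀ {m} → Vec Bool m → ℕ
countTrue [] = 0
countTrue (b ∷ bs) = (if b then 1 else 0) + countTrue bs

degA : ∀ {n} → BipGraph n → Vec ℕ n
degA M = V.map countTrue M

degB : ∀ {n} → BipGraph n → Vec ℕ n
degB M = V.map countTrue (transpose M)

-- h_1(n)(a_{i+1}) for 0-indexed i: n+1-(i+1) = n - i, except a_1 gets n-1
h1A : (n : ℕ) → Fin n → ℕ
h1A n i with toℕ i
... | zero = n ∸ 1
... | suc k = n ∸ suc k

-- h_1(n)(b_{j+1}) for 0-indexed j: j+1, except b_n gets n-1
h1B : (n : ℕ) → Fin n → ℕ
h1B n j with suc (toℕ j) ≟ n
... | yes _ = n ∸ 1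
... | no _ = suc (toℕ j)

IsRealization : (n : ℕ) → BipGraph n → Set
IsRealization n M = (degA M ≡ tabulate (h1A n)) × (degB M ≡ tabulate (h1B n))

isRealization? : (n : ℕ) → (M : BipGraph n) → Dec (IsRealization n M)
isRealization? n M =
  ≡-dec _≟_ (degA M) (tabulate (h1A n)) ×-dec ≡-dec _≟_ (degB M) (tabulate (h1B n))

allVecs : ∀ {A : Set} → List A → (m : ℕ) → List (Vec A m)
allVecs xs zero = [] ∷ []
allVecs xs (suc m) = cartesianProductWith _∷_ xs (allVecs xs m)

allBools : List Bool
allBools = false ∷ true ∷ []

allBipGraphs : (n : ℕ) → List (BipGraph n)
allBipGraphs n = allVecs (allVecs allBools n) n

numRealizations : ℕ → ℕ
numRealizations n = length (filter (isRealization? n) (allBipGraphs n))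

-- u n = φ^(2n) + φ^(-2n) where φ^2 = (3+√5)/2 (even-index Lucas numbers):
-- u 0 = 2, u 1 = 3, u (n+2) = 3 u (n+1) - u n.  Since 0 < φ^(-2n) ≤ 1,
-- u n - 1 ≤ ((3+√5)/2)^n < u n, so Θ(u n) = Θ(((3+√5)/2)^n).
u : ℕ → ℕ
u zero = 2
u (suc zero) = 3
u (suc (suc n)) = 3 * u (suc n) ∸ u n

{-# OPTIONS --safe #-}

-- Let H k be the number
-- of realizations of h₁(k+1), i.e. rows (k, k, k-1, …, 1) and columns
-- (1, 2, …, k, k), and S k the number with rows (k+1, k, …, 1) and columns
-- (1, 1, 2, …, k, k).  In both cases a₁ misses exactly one vertex of B and b₁ has
-- degree 1.  If a₁b₁ is an edge, b₁ is saturated and can be deleted; otherwise a₁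
-- is joined to all of B ∖ {b₁} and can be deleted.  After removing one more full
-- row or empty column this gives
--   H (k+1) = H k + S k,   S (k+1) = H (k+1) + S k,   H 0 = S 0 = 1,
-- so H k = F₂ₖ₊₁ and S k = F₂ₖ₊₂ are Fibonacci numbers, and u (k+1) = L₂ₖ₊₂ =
-- 2 H k + S k lies between H k and 4 H k.

module Submission where

open import Defs
open import Algebra using (CommutativeMonoid)
open import Data.Bool using (Bool; true; false; _∧_; if_then_else_)
open import Data.Bool.Properties using (∧-assoc; ∧-zeroʳ; ∧-commutativeMonoid)
open import Data.Fin using (Fin; toℕ)
import Data.Fin as Fin
open import Data.List using (List; []; _∷_; _++_; length; filter; cartesianProductWith)
import Data.List as List
open import Data.List.Properties using (map-++; map-∘)
open import Data.Nat using (ℕ; zero; suc; _+_; _*_; _∸_; _≤_; _≥_; _≡ᵇ_; z≤n; s≤s)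
open import Data.Nat.ListAction using (sum)
open import Data.Nat.ListAction.Properties using (sum-++)
open import Data.Nat.Properties
  using (_≟_; +-assoc; +-comm; +-identityˡ; +-identityʳ; *-identityˡ; *-zeroʳ; *-distribˡ-+;
         suc-injective; m≤n⇒m≤1+n; <⇒≢; ≤-trans; ≤-reflexive; m≤m+n; m≤n+m; +-monoʳ-≤;
         m+n∸n≡m; +-commutativeSemigroup; *-commutativeSemigroup)
open import Data.Nat.Tactic.RingSolver using (solve-∀)
open import Data.Product using (Σ; _×_; _,_; proj₁; proj₂)
open import Data.Vec using (Vec; []; _∷_; map; replicate; zipWith; tabulate; transpose; _⊛_)
open import Data.Vec.Properties
  using (≡-dec; zipWith-assoc; zipWith-identityˡ; zipWith-replicate₁; map-replicate; tabulate-cong; tabulate-∘)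
open import Function using (_∘_; const)
open import Relation.Binary.PropositionalEquality
  using (_≡_; refl; sym; trans; cong; cong₂; subst; module ≡-Reasoning)
open import Relation.Nullary using (Dec; does; yes; no)
open import Relation.Nullary.Decidable using (dec-false)
open import Data.Empty using (⊥-elim)

open import Algebra.Properties.CommutativeSemigroup +-commutativeSemigroup
  using () renaming (interchange to +-interchange; x∙yz≈y∙xz to +-exchange)
open import Algebra.Properties.CommutativeSemigroup *-commutativeSemigroup
  using () renaming (x∙yz≈y∙xz to *-exchange)
open import Algebra.Properties.CommutativeSemigroup
  (CommutativeMonoid.commutativeSemigroup ∧-commutativeMonoid)
  using () renaming (x∙yz≈y∙xz to ∧-exchange)

open ≡-Reasoning

Matrix : ℕ → ℕ → Set
Matrix m n = Vec (Vec Bool n) m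

∑ᵛ : ∀ n → (Vec Bool n → ℕ) → ℕ
∑ᵛ zero    f = f []
∑ᵛ (suc n) f = ∑ᵛ n (f ∘ (false ∷_)) + ∑ᵛ n (f ∘ (true ∷_))

∑ᴹ : ∀ m n → (Matrix m n → ℕ) → ℕ
∑ᴹ zero    n f = f []
∑ᴹ (suc m) n f = ∑ᵛ n (λ r → ∑ᴹ m n (f ∘ (r ∷_)))

∑ᵛ-cong : ∀ n {f g : Vec Bool n → ℕ} → (∀ v → f v ≡ g v) → ∑ᵛ n f ≡ ∑ᵛ n g
∑ᵛ-cong zero    f≡g = f≡g []
∑ᵛ-cong (suc n) f≡g = cong₂ _+_ (∑ᵛ-cong n (f≡g ∘ (false ∷_))) (∑ᵛ-cong n (f≡g ∘ (true ∷_)))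

∑ᵛ-zero : ∀ n → ∑ᵛ n (const 0) ≡ 0
∑ᵛ-zero zero    = refl
∑ᵛ-zero (suc n) = cong₂ _+_ (∑ᵛ-zero n) (∑ᵛ-zero n)

∑ᵛ-distrib-+ : ∀ n (f g : Vec Bool n → ℕ) → ∑ᵛ n (λ v → f v + g v) ≡ ∑ᵛ n f + ∑ᵛ n g
∑ᵛ-distrib-+ zero    f g = refl
∑ᵛ-distrib-+ (suc n) f g = begin
  ∑ᵛ n (λ v → f (false ∷ v) + g (false ∷ v)) + ∑ᵛ n (λ v → f (true ∷ v) + g (true ∷ v))
    ≡⟨ cong₂ _+_ (∑ᵛ-distrib-+ n _ _) (∑ᵛ-distrib-+ n _ _) ⟩
  (∑ᵛ n (f ∘ (false ∷_)) + ∑ᵛ n (g ∘ (false ∷_))) + (∑ᵛ n (f ∘ (true ∷_)) + ∑ᵛ n (g ∘ (true ∷_)))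
    ≡⟨ +-interchange (∑ᵛ n (f ∘ (false ∷_))) _ (∑ᵛ n (f ∘ (true ∷_))) _ ⟩
  ∑ᵛ (suc n) f + ∑ᵛ (suc n) g ∎

∑ᵛ-distribˡ-* : ∀ n a (f : Vec Bool n → ℕ) → ∑ᵛ n (λ v → a * f v) ≡ a * ∑ᵛ n f
∑ᵛ-distribˡ-* zero    a f = refl
∑ᵛ-distribˡ-* (suc n) a f = begin
  ∑ᵛ n (λ v → a * f (false ∷ v)) + ∑ᵛ n (λ v → a * f (true ∷ v))
    ≡⟨ cong₂ _+_ (∑ᵛ-distribˡ-* n a _) (∑ᵛ-distribˡ-* n a _) ⟩
  a * ∑ᵛ n (f ∘ (false ∷_)) + a * ∑ᵛ n (f ∘ (true ∷_))
    ≡⟨ *-distribˡ-+ a _ _ ⟨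
  a * ∑ᵛ (suc n) f ∎

∑ᵛ-comm : ∀ m n (f : Vec Bool m → Vec Bool n → ℕ) →
          ∑ᵛ m (λ r → ∑ᵛ n (f r)) ≡ ∑ᵛ n (λ s → ∑ᵛ m (λ r → f r s))
∑ᵛ-comm zero    n f = refl
∑ᵛ-comm (suc m) n f = begin
  ∑ᵛ m (λ r → ∑ᵛ n (f (false ∷ r))) + ∑ᵛ m (λ r → ∑ᵛ n (f (true ∷ r)))
    ≡⟨ cong₂ _+_ (∑ᵛ-comm m n _) (∑ᵛ-comm m n _) ⟩
  ∑ᵛ n (λ s → ∑ᵛ m (λ r → f (false ∷ r) s)) + ∑ᵛ n (λ s → ∑ᵛ m (λ r → f (true ∷ r) s))
    ≡⟨ ∑ᵛ-distrib-+ n _ _ ⟨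
  ∑ᵛ n (λ s → ∑ᵛ (suc m) (λ r → f r s)) ∎

∑ᵛ-swap₀₁ : ∀ n (f g : Vec Bool (2 + n) → ℕ) → (∀ x y v → f (x ∷ y ∷ v) ≡ g (y ∷ x ∷ v)) →
            ∑ᵛ (2 + n) f ≡ ∑ᵛ (2 + n) g
∑ᵛ-swap₀₁ n f g f≡g = begin
  (∑ᵛ n (f ∘ (false ∷_) ∘ (false ∷_)) + ∑ᵛ n (f ∘ (false ∷_) ∘ (true ∷_))) +
  (∑ᵛ n (f ∘ (true ∷_) ∘ (false ∷_)) + ∑ᵛ n (f ∘ (true ∷_) ∘ (true ∷_)))
    ≡⟨ cong₂ _+_ (cong₂ _+_ (∑ᵛ-cong n (f≡g false false)) (∑ᵛ-cong n (f≡g false true)))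
                 (cong₂ _+_ (∑ᵛ-cong n (f≡g true false)) (∑ᵛ-cong n (f≡g true true))) ⟩
  (∑ᵛ n (g ∘ (false ∷_) ∘ (false ∷_)) + ∑ᵛ n (g ∘ (true ∷_) ∘ (false ∷_))) +
  (∑ᵛ n (g ∘ (false ∷_) ∘ (true ∷_)) + ∑ᵛ n (g ∘ (true ∷_) ∘ (true ∷_)))
    ≡⟨ +-interchange (∑ᵛ n (g ∘ (false ∷_) ∘ (false ∷_))) _ (∑ᵛ n (g ∘ (false ∷_) ∘ (true ∷_))) _ ⟩
  ∑ᵛ (2 + n) g ∎

∑ᴹ-cong : ∀ m n {f g : Matrix m n → ℕ} → (∀ M → f M ≡ g M) → ∑ᴹ m n f ≡ ∑ᴹ m n g
∑ᴹ-cong zero    n f≡g = f≡g []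
∑ᴹ-cong (suc m) n f≡g = ∑ᵛ-cong n (λ r → ∑ᴹ-cong m n (f≡g ∘ (r ∷_)))

∑ᴹ-zero : ∀ m n → ∑ᴹ m n (const 0) ≡ 0
∑ᴹ-zero zero    n = refl
∑ᴹ-zero (suc m) n = trans (∑ᵛ-cong n (λ _ → ∑ᴹ-zero m n)) (∑ᵛ-zero n)

∑ᴹ-distribˡ-* : ∀ m n a (f : Matrix m n → ℕ) → ∑ᴹ m n (λ M → a * f M) ≡ a * ∑ᴹ m n f
∑ᴹ-distribˡ-* zero    n a f = refl
∑ᴹ-distribˡ-* (suc m) n a f =
  trans (∑ᵛ-cong n (λ r → ∑ᴹ-distribˡ-* m n a (f ∘ (r ∷_)))) (∑ᵛ-distribˡ-* n a _)

-- The same expression as the summand of countTrue, so that countTrue (b ∷ v)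
-- reduces to 𝟙 b + countTrue v.
𝟙 : Bool → ℕ
𝟙 b = if b then 1 else 0

𝟙-∧ : ∀ a b → 𝟙 (a ∧ b) ≡ 𝟙 a * 𝟙 b
𝟙-∧ false b = refl
𝟙-∧ true  b = sym (*-identityˡ (𝟙 b))

countTrue≤length : ∀ {n} (v : Vec Bool n) → countTrue v ≤ n
countTrue≤length []          = z≤n
countTrue≤length (false ∷ v) = m≤n⇒m≤1+n (countTrue≤length v)
countTrue≤length (true  ∷ v) = s≤s (countTrue≤length v)

∑ᵛ-fullRow : ∀ n (f : Vec Bool n → ℕ) →
             ∑ᵛ n (λ s → 𝟙 (countTrue s ≡ᵇ n) * f s) ≡ f (replicate n true)
∑ᵛ-fullRow zero    f = *-identityˡ (f [])
∑ᵛ-fullRow (suc n) f = cong₂ _+_ noZero (∑ᵛ-fullRow n (f ∘ (true ∷_)))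
  where
  noZero : ∑ᵛ n (λ s → 𝟙 (countTrue s ≡ᵇ suc n) * f (false ∷ s)) ≡ 0
  noZero = trans (∑ᵛ-cong n λ s → cong (λ b → 𝟙 b * f (false ∷ s))
                   (dec-false (countTrue s ≟ suc n) (<⇒≢ (s≤s (countTrue≤length s)))))
                 (∑ᵛ-zero n)

infix 4 _≡ᵛ_
infixl 6 _⊕_

-- The test used by isRealization?; on cons cells it reduces to _≡ᵇ_ and _∧_.
_≡ᵛ_ : ∀ {n} → Vec ℕ n → Vec ℕ n → Bool
v ≡ᵛ w = does (≡-dec _≟_ v w)

_⊕_ : ∀ {n} → Vec ℕ n → Vec ℕ n → Vec ℕ n
_⊕_ = zipWith _+_

⊕-assoc : ∀ {n} (xs ys zs : Vec ℕ n) → (xs ⊕ ys) ⊕ zs ≡ xs ⊕ (ys ⊕ zs)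
⊕-assoc = zipWith-assoc +-assoc

⊕-exchange : ∀ {n} (xs ys zs : Vec ℕ n) → xs ⊕ (ys ⊕ zs) ≡ ys ⊕ (xs ⊕ zs)
⊕-exchange []       []       []       = refl
⊕-exchange (x ∷ xs) (y ∷ ys) (z ∷ zs) = cong₂ _∷_ (+-exchange x y z) (⊕-exchange xs ys zs)

≡ᵇ-cancelˡ-+ : ∀ a x y → (a + x ≡ᵇ a + y) ≡ (x ≡ᵇ y)
≡ᵇ-cancelˡ-+ zero    x y = refl
≡ᵇ-cancelˡ-+ (suc a) x y = ≡ᵇ-cancelˡ-+ a x y

≡ᵛ-cancelˡ-⊕ : ∀ {n} (xs ys zs : Vec ℕ n) → (xs ⊕ ys ≡ᵛ xs ⊕ zs) ≡ (ys ≡ᵛ zs)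
≡ᵛ-cancelˡ-⊕ []       []       []       = refl
≡ᵛ-cancelˡ-⊕ (x ∷ xs) (y ∷ ys) (z ∷ zs) = cong₂ _∧_ (≡ᵇ-cancelˡ-+ x y z) (≡ᵛ-cancelˡ-⊕ xs ys zs)

rowSums : ∀ {m n} → Matrix m n → Vec ℕ m
rowSums = map countTrue

colSums : ∀ {m n} → Matrix m n → Vec ℕ n
colSums M = map countTrue (transpose M)

bits : ∀ {n} → Vec Bool n → Vec ℕ n
bits = map 𝟙

colSums-∷ : ∀ {m n} (r : Vec Bool n) (M : Matrix m n) → colSums (r ∷ M) ≡ bits r ⊕ colSums M
colSums-∷ r M = prepend r (transpose M)
  where
  prepend : ∀ {m n} (r : Vec Bool n) (T : Vec (Vec Bool m) n) →
            map countTrue ((replicate n _∷_ ⊛ r) ⊛ T) ≡ bits r ⊕ map countTrue T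
  prepend []      []      = refl
  prepend (b ∷ r) (t ∷ T) = cong (𝟙 b + countTrue t ∷_) (prepend r T)

-- The offset o records the column degrees used up by rows already removed.
count : ∀ m n → Vec ℕ m → Vec ℕ n → Vec ℕ n → ℕ
count m n r c o = ∑ᴹ m n (λ M → 𝟙 ((rowSums M ≡ᵛ r) ∧ (o ⊕ colSums M ≡ᵛ c)))

count-cong : ∀ {m n} (r : Vec ℕ m) (c o c′ o′ : Vec ℕ n) →
             (∀ w → (o ⊕ w ≡ᵛ c) ≡ (o′ ⊕ w ≡ᵛ c′)) → count m n r c o ≡ count m n r c′ o′
count-cong {m} {n} r c o c′ o′ eq =
  ∑ᴹ-cong m n (λ M → cong (λ b → 𝟙 ((rowSums M ≡ᵛ r) ∧ b)) (eq (colSums M)))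

count-cancelˡ : ∀ {m n} (r : Vec ℕ m) (v c o : Vec ℕ n) → count m n r (v ⊕ c) (v ⊕ o) ≡ count m n r c o
count-cancelˡ r v c o = count-cong r (v ⊕ c) (v ⊕ o) c o λ w →
  trans (cong (_≡ᵛ v ⊕ c) (⊕-assoc v o w)) (≡ᵛ-cancelˡ-⊕ v (o ⊕ w) c)

count-peelRow : ∀ {m n} d (r : Vec ℕ m) (c o : Vec ℕ n) →
                count (suc m) n (d ∷ r) c o ≡ ∑ᵛ n (λ s → 𝟙 (countTrue s ≡ᵇ d) * count m n r c (bits s ⊕ o))
count-peelRow {m} {n} d r c o = ∑ᵛ-cong n peel
  where
  offset-∷ : ∀ s M → o ⊕ colSums (s ∷ M) ≡ (bits s ⊕ o) ⊕ colSums M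
  offset-∷ s M = begin
    o ⊕ colSums (s ∷ M)       ≡⟨ cong (o ⊕_) (colSums-∷ s M) ⟩
    o ⊕ (bits s ⊕ colSums M)  ≡⟨ ⊕-exchange o (bits s) (colSums M) ⟩
    bits s ⊕ (o ⊕ colSums M)  ≡⟨ ⊕-assoc (bits s) o (colSums M) ⟨
    (bits s ⊕ o) ⊕ colSums M  ∎

  peel : ∀ s → ∑ᴹ m n (λ M → 𝟙 ((rowSums (s ∷ M) ≡ᵛ d ∷ r) ∧ (o ⊕ colSums (s ∷ M) ≡ᵛ c)))
             ≡ 𝟙 (countTrue s ≡ᵇ d) * count m n r c (bits s ⊕ o)
  peel s = begin
    ∑ᴹ m n (λ M → 𝟙 ((rowSums (s ∷ M) ≡ᵛ d ∷ r) ∧ (o ⊕ colSums (s ∷ M) ≡ᵛ c)))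
      ≡⟨⟩
    ∑ᴹ m n (λ M → 𝟙 (((countTrue s ≡ᵇ d) ∧ (rowSums M ≡ᵛ r)) ∧ (o ⊕ colSums (s ∷ M) ≡ᵛ c)))
      ≡⟨ ∑ᴹ-cong m n (λ M → cong 𝟙 (∧-assoc (countTrue s ≡ᵇ d) _ _)) ⟩
    ∑ᴹ m n (λ M → 𝟙 ((countTrue s ≡ᵇ d) ∧ ((rowSums M ≡ᵛ r) ∧ (o ⊕ colSums (s ∷ M) ≡ᵛ c))))
      ≡⟨ ∑ᴹ-cong m n (λ M → 𝟙-∧ (countTrue s ≡ᵇ d) _) ⟩
    ∑ᴹ m n (λ M → 𝟙 (countTrue s ≡ᵇ d) * 𝟙 ((rowSums M ≡ᵛ r) ∧ (o ⊕ colSums (s ∷ M) ≡ᵛ c)))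
      ≡⟨ ∑ᴹ-distribˡ-* m n (𝟙 (countTrue s ≡ᵇ d)) _ ⟩
    𝟙 (countTrue s ≡ᵇ d) * ∑ᴹ m n (λ M → 𝟙 ((rowSums M ≡ᵛ r) ∧ (o ⊕ colSums (s ∷ M) ≡ᵛ c)))
      ≡⟨ cong (𝟙 (countTrue s ≡ᵇ d) *_) (∑ᴹ-cong m n λ M →
           cong (λ w → 𝟙 ((rowSums M ≡ᵛ r) ∧ (w ≡ᵛ c))) (offset-∷ s M)) ⟩
    𝟙 (countTrue s ≡ᵇ d) * count m n r c (bits s ⊕ o) ∎

count-fullRow : ∀ {m n} (r : Vec ℕ m) (c o : Vec ℕ n) →
                count (suc m) n (n ∷ r) c o ≡ count m n r c (replicate n 1 ⊕ o)
count-fullRow {m} {n} r c o = begin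
  count (suc m) n (n ∷ r) c o
    ≡⟨ count-peelRow n r c o ⟩
  ∑ᵛ n (λ s → 𝟙 (countTrue s ≡ᵇ n) * count m n r c (bits s ⊕ o))
    ≡⟨ ∑ᵛ-fullRow n _ ⟩
  count m n r c (bits (replicate n true) ⊕ o)
    ≡⟨ cong (λ v → count m n r c (v ⊕ o)) (map-replicate 𝟙 true n) ⟩
  count m n r c (replicate n 1 ⊕ o) ∎

count-swapRows : ∀ {m n} d e (r : Vec ℕ m) (c o : Vec ℕ n) →
                 count (2 + m) n (d ∷ e ∷ r) c o ≡ count (2 + m) n (e ∷ d ∷ r) c o
count-swapRows {m} {n} d e r c o = begin
  count (2 + m) n (d ∷ e ∷ r) c o         ≡⟨ peelTwo d e ⟩
  ∑ᵛ n (λ s → ∑ᵛ n (term d e s))          ≡⟨ ∑ᵛ-comm n n (term d e) ⟩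
  ∑ᵛ n (λ t → ∑ᵛ n (λ s → term d e s t))  ≡⟨ ∑ᵛ-cong n (λ t → ∑ᵛ-cong n (swap t)) ⟩
  ∑ᵛ n (λ t → ∑ᵛ n (term e d t))          ≡⟨ peelTwo e d ⟨
  count (2 + m) n (e ∷ d ∷ r) c o         ∎
  where
  term : ℕ → ℕ → Vec Bool n → Vec Bool n → ℕ
  term d e s t = 𝟙 (countTrue s ≡ᵇ d) * (𝟙 (countTrue t ≡ᵇ e) * count m n r c (bits t ⊕ (bits s ⊕ o)))

  peelTwo : ∀ d e → count (2 + m) n (d ∷ e ∷ r) c o ≡ ∑ᵛ n (λ s → ∑ᵛ n (term d e s))
  peelTwo d e = begin
    count (2 + m) n (d ∷ e ∷ r) c o
      ≡⟨ count-peelRow d (e ∷ r) c o ⟩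
    ∑ᵛ n (λ s → 𝟙 (countTrue s ≡ᵇ d) * count (suc m) n (e ∷ r) c (bits s ⊕ o))
      ≡⟨ ∑ᵛ-cong n (λ s → cong (𝟙 (countTrue s ≡ᵇ d) *_) (count-peelRow e r c (bits s ⊕ o))) ⟩
    ∑ᵛ n (λ s → 𝟙 (countTrue s ≡ᵇ d) *
                ∑ᵛ n (λ t → 𝟙 (countTrue t ≡ᵇ e) * count m n r c (bits t ⊕ (bits s ⊕ o))))
      ≡⟨ ∑ᵛ-cong n (λ s → ∑ᵛ-distribˡ-* n (𝟙 (countTrue s ≡ᵇ d)) _) ⟨
    ∑ᵛ n (λ s → ∑ᵛ n (term d e s)) ∎

  swap : ∀ t s → term d e s t ≡ term e d t s
  swap t s = trans (*-exchange (𝟙 (countTrue s ≡ᵇ d)) (𝟙 (countTrue t ≡ᵇ e)) _)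
                   (cong (λ w → 𝟙 (countTrue t ≡ᵇ e) * (𝟙 (countTrue s ≡ᵇ d) * count m n r c w))
                         (⊕-exchange (bits t) (bits s) o))

count-swapCols : ∀ {m n} (r : Vec ℕ m) a b (c : Vec ℕ n) x y (o : Vec ℕ n) →
                 count m (2 + n) r (a ∷ b ∷ c) (x ∷ y ∷ o) ≡ count m (2 + n) r (b ∷ a ∷ c) (y ∷ x ∷ o)
count-swapCols []      a b c x y o = cong 𝟙 (∧-exchange (x + 0 ≡ᵇ a) (y + 0 ≡ᵇ b) _)
count-swapCols {suc m} {n} (d ∷ r) a b c x y o = begin
  count (suc m) (2 + n) (d ∷ r) (a ∷ b ∷ c) (x ∷ y ∷ o)
    ≡⟨ count-peelRow d r (a ∷ b ∷ c) (x ∷ y ∷ o) ⟩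
  ∑ᵛ (2 + n) (λ s → 𝟙 (countTrue s ≡ᵇ d) * count m (2 + n) r (a ∷ b ∷ c) (bits s ⊕ (x ∷ y ∷ o)))
    ≡⟨ ∑ᵛ-swap₀₁ n (term a b x y) (term b a y x) swap ⟩
  ∑ᵛ (2 + n) (λ s → 𝟙 (countTrue s ≡ᵇ d) * count m (2 + n) r (b ∷ a ∷ c) (bits s ⊕ (y ∷ x ∷ o)))
    ≡⟨ count-peelRow d r (b ∷ a ∷ c) (y ∷ x ∷ o) ⟨
  count (suc m) (2 + n) (d ∷ r) (b ∷ a ∷ c) (y ∷ x ∷ o) ∎
  where
  term : ℕ → ℕ → ℕ → ℕ → Vec Bool (2 + n) → ℕ
  term a b x y s = 𝟙 (countTrue s ≡ᵇ d) * count m (2 + n) r (a ∷ b ∷ c) (bits s ⊕ (x ∷ y ∷ o))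

  swap : ∀ p q s → term a b x y (p ∷ q ∷ s) ≡ term b a y x (q ∷ p ∷ s)
  swap p q s = cong₂ _*_ (cong (λ k → 𝟙 (k ≡ᵇ d)) (+-exchange (𝟙 p) (𝟙 q) (countTrue s)))
                         (count-swapCols r a b c (𝟙 p + x) (𝟙 q + y) (bits s ⊕ o))

count-overfull : ∀ {m n} (r : Vec ℕ m) (c o : Vec ℕ n) x → count m (suc n) r (0 ∷ c) (suc x ∷ o) ≡ 0
count-overfull {m} {n} r c o x = trans (∑ᴹ-cong m (suc n) vanishes) (∑ᴹ-zero m (suc n))
  where
  mismatch : ∀ w → ((suc x ∷ o) ⊕ w ≡ᵛ 0 ∷ c) ≡ false
  mismatch (y ∷ w) = refl

  vanishes : ∀ M → 𝟙 ((rowSums M ≡ᵛ r) ∧ ((suc x ∷ o) ⊕ colSums M ≡ᵛ 0 ∷ c)) ≡ 0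
  vanishes M = cong 𝟙 (trans (cong ((rowSums M ≡ᵛ r) ∧_) (mismatch (colSums M))) (∧-zeroʳ (rowSums M ≡ᵛ r)))

count-dropZeroCol : ∀ {m n} (r : Vec ℕ m) (c o : Vec ℕ n) → count m (suc n) r (0 ∷ c) (0 ∷ o) ≡ count m n r c o
count-dropZeroCol []      c o = refl
count-dropZeroCol {suc m} {n} (d ∷ r) c o = begin
  count (suc m) (suc n) (d ∷ r) (0 ∷ c) (0 ∷ o)
    ≡⟨ count-peelRow d r (0 ∷ c) (0 ∷ o) ⟩
  ∑ᵛ n (λ s → 𝟙 (countTrue s ≡ᵇ d) * count m (suc n) r (0 ∷ c) (0 ∷ bits s ⊕ o)) + entryOne
    ≡⟨ cong₂ _+_ (∑ᵛ-cong n λ s → cong (𝟙 (countTrue s ≡ᵇ d) *_) (count-dropZeroCol r c (bits s ⊕ o)))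
                 noEntryOne ⟩
  ∑ᵛ n (λ s → 𝟙 (countTrue s ≡ᵇ d) * count m n r c (bits s ⊕ o)) + 0
    ≡⟨ +-identityʳ _ ⟩
  ∑ᵛ n (λ s → 𝟙 (countTrue s ≡ᵇ d) * count m n r c (bits s ⊕ o))
    ≡⟨ count-peelRow d r c o ⟨
  count (suc m) n (d ∷ r) c o ∎
  where
  entryOne : ℕ
  entryOne = ∑ᵛ n (λ s → 𝟙 (suc (countTrue s) ≡ᵇ d) * count m (suc n) r (0 ∷ c) (1 ∷ bits s ⊕ o))

  noEntryOne : entryOne ≡ 0
  noEntryOne = trans (∑ᵛ-cong n vanishes) (∑ᵛ-zero n)
    where
    vanishes : ∀ s → 𝟙 (suc (countTrue s) ≡ᵇ d) * count m (suc n) r (0 ∷ c) (1 ∷ bits s ⊕ o) ≡ 0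
    vanishes s = trans (cong (𝟙 (suc (countTrue s) ≡ᵇ d) *_) (count-overfull r c (bits s ⊕ o) 0))
                       (*-zeroʳ (𝟙 (suc (countTrue s) ≡ᵇ d)))

count-splitCorner : ∀ {m n} (r : Vec ℕ m) (c o : Vec ℕ (suc n)) →
  count (suc m) (2 + n) (suc n ∷ r) (1 ∷ c) (0 ∷ o) ≡
  count (suc m) (suc n) (n ∷ r) c o + count m (2 + n) r (1 ∷ c) (0 ∷ replicate (suc n) 1 ⊕ o)
count-splitCorner {m} {n} r c o = begin
  count (suc m) (2 + n) (suc n ∷ r) (1 ∷ c) (0 ∷ o)  ≡⟨ count-peelRow (suc n) r (1 ∷ c) (0 ∷ o) ⟩
  cornerAbsent + cornerPresent                       ≡⟨ +-comm cornerAbsent cornerPresent ⟩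
  cornerPresent + cornerAbsent                       ≡⟨ cong₂ _+_ present absent ⟩
  count (suc m) (suc n) (n ∷ r) c o + count m (2 + n) r (1 ∷ c) (0 ∷ replicate (suc n) 1 ⊕ o) ∎
  where
  cornerAbsent cornerPresent : ℕ
  cornerAbsent  = ∑ᵛ (suc n) (λ s → 𝟙 (countTrue s ≡ᵇ suc n) * count m (2 + n) r (1 ∷ c) (0 ∷ bits s ⊕ o))
  cornerPresent = ∑ᵛ (suc n) (λ s → 𝟙 (countTrue s ≡ᵇ n) * count m (2 + n) r (1 ∷ c) (1 ∷ bits s ⊕ o))

  absent : cornerAbsent ≡ count m (2 + n) r (1 ∷ c) (0 ∷ replicate (suc n) 1 ⊕ o)
  absent = trans (∑ᵛ-fullRow (suc n) (λ s → count m (2 + n) r (1 ∷ c) (0 ∷ bits s ⊕ o)))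
                 (cong (λ v → count m (2 + n) r (1 ∷ c) (0 ∷ v ⊕ o)) (map-replicate 𝟙 true (suc n)))

  saturated : ∀ o′ → count m (2 + n) r (1 ∷ c) (1 ∷ o′) ≡ count m (suc n) r c o′
  saturated o′ = trans (count-cong r (1 ∷ c) (1 ∷ o′) (0 ∷ c) (0 ∷ o′) (λ { (x ∷ w) → refl }))
                       (count-dropZeroCol r c o′)

  present : cornerPresent ≡ count (suc m) (suc n) (n ∷ r) c o
  present = trans (∑ᵛ-cong (suc n) λ s → cong (𝟙 (countTrue s ≡ᵇ n) *_) (saturated (bits s ⊕ o)))
                  (sym (count-peelRow n r c o))

descending : ∀ n → Vec ℕ n
descending zero    = []
descending (suc n) = suc n ∷ descending n

-- Built with ⊕ rather than map suc so that the degree shifts in H-suc and S-suc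
-- are instances of count-cancelˡ on the nose.
h₁Cols : ∀ k → Vec ℕ (suc k)
h₁Cols zero    = 0 ∷ []
h₁Cols (suc k) = 1 ∷ replicate (suc k) 1 ⊕ h₁Cols k

H S : ℕ → ℕ
H k = count (suc k) (suc k) (k ∷ descending k) (h₁Cols k) (replicate (suc k) 0)
S k = count (suc k) (2 + k) (descending (suc k)) (1 ∷ h₁Cols k) (replicate (2 + k) 0)

H-suc : ∀ k → H (suc k) ≡ H k + S k
H-suc k = begin
  H (suc k)
    ≡⟨ count-splitCorner (suc k ∷ descending k) (replicate (suc k) 1 ⊕ h₁Cols k) (replicate (suc k) 0) ⟩
  count (2 + k) (suc k) (k ∷ suc k ∷ descending k) (ones ⊕ h₁Cols k) zeros +
  count (suc k) (2 + k) (descending (suc k)) (1 ∷ ones ⊕ h₁Cols k) (0 ∷ ones ⊕ zeros)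
    ≡⟨ cong (_+ S′) (count-swapRows k (suc k) (descending k) (ones ⊕ h₁Cols k) zeros) ⟩
  count (2 + k) (suc k) (suc k ∷ k ∷ descending k) (ones ⊕ h₁Cols k) zeros + S′
    ≡⟨ cong (_+ S′) (count-fullRow (k ∷ descending k) (ones ⊕ h₁Cols k) zeros) ⟩
  count (suc k) (suc k) (k ∷ descending k) (ones ⊕ h₁Cols k) (ones ⊕ zeros) + S′
    ≡⟨ cong₂ _+_ (count-cancelˡ (k ∷ descending k) ones (h₁Cols k) zeros)
                 (count-cancelˡ (descending (suc k)) (0 ∷ ones) (1 ∷ h₁Cols k) (0 ∷ zeros)) ⟩
  H k + S k ∎
  where
  ones zeros : Vec ℕ (suc k)
  ones  = replicate (suc k) 1
  zeros = replicate (suc k) 0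
  S′ : ℕ
  S′ = count (suc k) (2 + k) (descending (suc k)) (1 ∷ ones ⊕ h₁Cols k) (0 ∷ ones ⊕ zeros)

S-suc : ∀ k → S (suc k) ≡ H (suc k) + S k
S-suc k = begin
  S (suc k)
    ≡⟨ count-splitCorner rows (h₁Cols (suc k)) (replicate (2 + k) 0) ⟩
  H (suc k) + count (suc k) (3 + k) rows (1 ∷ 1 ∷ ones ⊕ h₁Cols k) (0 ∷ 1 ∷ ones ⊕ zeros)
    ≡⟨ cong (H (suc k) +_) (count-cancelˡ rows (0 ∷ 1 ∷ ones) (1 ∷ 0 ∷ h₁Cols k) (0 ∷ 0 ∷ zeros)) ⟩
  H (suc k) + count (suc k) (3 + k) rows (1 ∷ 0 ∷ h₁Cols k) (0 ∷ 0 ∷ zeros)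
    ≡⟨ cong (H (suc k) +_) (count-swapCols rows 1 0 (h₁Cols k) 0 0 zeros) ⟩
  H (suc k) + count (suc k) (3 + k) rows (0 ∷ 1 ∷ h₁Cols k) (0 ∷ 0 ∷ zeros)
    ≡⟨ cong (H (suc k) +_) (count-dropZeroCol rows (1 ∷ h₁Cols k) (0 ∷ zeros)) ⟩
  H (suc k) + S k ∎
  where
  rows : Vec ℕ (suc k)
  rows = descending (suc k)
  ones zeros : Vec ℕ (suc k)
  ones  = replicate (suc k) 1
  zeros = replicate (suc k) 0

length-filter≡sum : ∀ {A : Set} {P : A → Set} (P? : ∀ x → Dec (P x)) (xs : List A) →
                    length (filter P? xs) ≡ sum (List.map (𝟙 ∘ does ∘ P?) xs)
length-filter≡sum P? []       = refl
length-filter≡sum P? (x ∷ xs) with does (P? x)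
... | true  = cong suc (length-filter≡sum P? xs)
... | false = length-filter≡sum P? xs

sum-cartesianProductWith : ∀ {A B C : Set} (g : C → ℕ) (f : A → B → C) (xs : List A) (ys : List B) →
  sum (List.map g (cartesianProductWith f xs ys)) ≡ sum (List.map (λ x → sum (List.map (g ∘ f x) ys)) xs)
sum-cartesianProductWith g f []       ys = refl
sum-cartesianProductWith g f (x ∷ xs) ys = begin
  sum (List.map g (List.map (f x) ys ++ cartesianProductWith f xs ys))
    ≡⟨ cong sum (map-++ g (List.map (f x) ys) _) ⟩
  sum (List.map g (List.map (f x) ys) ++ List.map g (cartesianProductWith f xs ys))
    ≡⟨ sum-++ (List.map g (List.map (f x) ys)) _ ⟩
  sum (List.map g (List.map (f x) ys)) + sum (List.map g (cartesianProductWith f xs ys))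
    ≡⟨ cong₂ _+_ (cong sum (sym (map-∘ ys))) (sum-cartesianProductWith g f xs ys) ⟩
  sum (List.map (g ∘ f x) ys) + sum (List.map (λ x → sum (List.map (g ∘ f x) ys)) xs) ∎

sum-allVecs-Bool : ∀ n (f : Vec Bool n → ℕ) → sum (List.map f (allVecs allBools n)) ≡ ∑ᵛ n f
sum-allVecs-Bool zero    f = +-identityʳ (f [])
sum-allVecs-Bool (suc n) f = begin
  sum (List.map f (allVecs allBools (suc n)))
    ≡⟨ sum-cartesianProductWith f _∷_ allBools (allVecs allBools n) ⟩
  sum (List.map (f ∘ (false ∷_)) (allVecs allBools n)) + (sum (List.map (f ∘ (true ∷_)) (allVecs allBools n)) + 0)
    ≡⟨ cong₂ _+_ (sum-allVecs-Bool n _) (trans (+-identityʳ _) (sum-allVecs-Bool n _)) ⟩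
  ∑ᵛ (suc n) f ∎

sum-allMatrices : ∀ m n (f : Matrix m n → ℕ) → sum (List.map f (allVecs (allVecs allBools n) m)) ≡ ∑ᴹ m n f
sum-allMatrices zero    n f = +-identityʳ (f [])
sum-allMatrices (suc m) n f = begin
  sum (List.map f (allVecs (allVecs allBools n) (suc m)))
    ≡⟨ sum-cartesianProductWith f _∷_ (allVecs allBools n) (allVecs (allVecs allBools n) m) ⟩
  sum (List.map (λ r → sum (List.map (f ∘ (r ∷_)) (allVecs (allVecs allBools n) m))) (allVecs allBools n))
    ≡⟨ sum-allVecs-Bool n _ ⟩
  ∑ᵛ n (λ r → sum (List.map (f ∘ (r ∷_)) (allVecs (allVecs allBools n) m)))
    ≡⟨ ∑ᵛ-cong n (λ r → sum-allMatrices m n (f ∘ (r ∷_))) ⟩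
  ∑ᴹ (suc m) n f ∎

numRealizations≡count : ∀ n → numRealizations n ≡ count n n (tabulate (h1A n)) (tabulate (h1B n)) (replicate n 0)
numRealizations≡count n = begin
  numRealizations n
    ≡⟨ length-filter≡sum (isRealization? n) (allBipGraphs n) ⟩
  sum (List.map (𝟙 ∘ does ∘ isRealization? n) (allBipGraphs n))
    ≡⟨ sum-allMatrices n n _ ⟩
  ∑ᴹ n n (λ M → 𝟙 ((rowSums M ≡ᵛ tabulate (h1A n)) ∧ (colSums M ≡ᵛ tabulate (h1B n))))
    ≡⟨ ∑ᴹ-cong n n (λ M → cong (λ w → 𝟙 ((rowSums M ≡ᵛ tabulate (h1A n)) ∧ (w ≡ᵛ tabulate (h1B n))))
                               (sym (zipWith-identityˡ +-identityˡ (colSums M)))) ⟩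
  count n n (tabulate (h1A n)) (tabulate (h1B n)) (replicate n 0) ∎

h1B-suc : ∀ k (j : Fin (suc k)) → h1B (2 + k) (Fin.suc j) ≡ suc (h1B (suc k) j)
h1B-suc k j with suc (suc (toℕ j)) ≟ suc (suc k) | suc (toℕ j) ≟ suc k
... | yes _   | yes _  = refl
... | no _    | no _   = refl
... | yes p   | no ¬p  = ⊥-elim (¬p (suc-injective p))
... | no ¬p   | yes p  = ⊥-elim (¬p (cong suc p))

tabulate-h1B : ∀ k → tabulate (h1B (suc k)) ≡ h₁Cols k
tabulate-h1B zero    = refl
tabulate-h1B (suc k) = cong (1 ∷_) (begin
  tabulate (h1B (2 + k) ∘ Fin.suc)              ≡⟨ tabulate-cong (h1B-suc k) ⟩
  tabulate (suc ∘ h1B (suc k))                  ≡⟨ tabulate-∘ suc (h1B (suc k)) ⟩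
  map suc (tabulate (h1B (suc k)))              ≡⟨ zipWith-replicate₁ _+_ 1 (tabulate (h1B (suc k))) ⟨
  replicate (suc k) 1 ⊕ tabulate (h1B (suc k))  ≡⟨ cong (replicate (suc k) 1 ⊕_) (tabulate-h1B k) ⟩
  replicate (suc k) 1 ⊕ h₁Cols k                ∎)

tabulate-h1A : ∀ k → tabulate (h1A (suc k)) ≡ k ∷ descending k
tabulate-h1A k = cong (k ∷_) (tabulate-descending k)
  where
  tabulate-descending : ∀ k → tabulate (λ (i : Fin k) → k ∸ toℕ i) ≡ descending k
  tabulate-descending zero    = refl
  tabulate-descending (suc k) = cong (suc k ∷_) (tabulate-descending k)

numRealizations-suc : ∀ k → numRealizations (suc k) ≡ H k
numRealizations-suc k =
  trans (numRealizations≡count (suc k))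
        (cong₂ (λ r c → count (suc k) (suc k) r c (replicate (suc k) 0)) (tabulate-h1A k) (tabulate-h1B k))

S≤H+H : ∀ k → S k ≤ H k + H k
S≤H+H zero    = s≤s z≤n
S≤H+H (suc k) = ≤-trans (≤-reflexive (S-suc k)) (+-monoʳ-≤ (H (suc k)) S≤H-suc)
  where
  S≤H-suc : S k ≤ H (suc k)
  S≤H-suc = ≤-trans (m≤n+m (S k) (H k)) (≤-reflexive (sym (H-suc k)))

lucas-step : ∀ h s h′ s′ h″ s″ →
             h′ ≡ h + s → s′ ≡ h′ + s → h″ ≡ h′ + s′ → s″ ≡ h″ + s′ →
             3 * (2 * h′ + s′) ∸ (2 * h + s) ≡ 2 * h″ + s″
lucas-step h s _ _ _ _ refl refl refl refl =
  trans (cong (_∸ (2 * h + s)) (identity h s)) (m+n∸n≡m _ (2 * h + s))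
  where
  identity : ∀ h s → 3 * (2 * (h + s) + (h + s + s)) ≡
                     2 * (h + s + (h + s + s)) + (h + s + (h + s + s) + (h + s + s)) + (2 * h + s)
  identity = solve-∀

u-suc : ∀ k → u (suc k) ≡ 2 * H k + S k
u-suc k = proj₁ (consecutive k)
  where
  consecutive : ∀ k → u (suc k) ≡ 2 * H k + S k × u (2 + k) ≡ 2 * H (suc k) + S (suc k)
  consecutive zero    =
    refl , sym (cong₂ (λ h s → 2 * h + s) (H-suc 0) (trans (S-suc 0) (cong (_+ S 0) (H-suc 0))))
  consecutive (suc k) = q , trans (cong₂ (λ a b → 3 * a ∸ b) q p)
                                  (lucas-step (H k) (S k) _ _ _ _ (H-suc k) (S-suc k) (H-suc (suc k)) (S-suc (suc k)))
    where
    p : u (suc k) ≡ 2 * H k + S k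
    p = proj₁ (consecutive k)
    q : u (2 + k) ≡ 2 * H (suc k) + S (suc k)
    q = proj₂ (consecutive k)

u≤4H : ∀ k → u (suc k) ≤ 4 * H k
u≤4H k = ≤-trans (≤-reflexive (u-suc k))
                 (≤-trans (+-monoʳ-≤ (2 * H k) (S≤H+H k)) (≤-reflexive (twice-double (H k))))
  where
  twice-double : ∀ h → 2 * h + (h + h) ≡ 4 * h
  twice-double = solve-∀

H≤u : ∀ k → H k ≤ u (suc k)
H≤u k = ≤-trans (m≤m+n (H k) (H k + 0)) (≤-trans (m≤m+n (2 * H k) (S k)) (≤-reflexive (sym (u-suc k))))

mainTheorem10 : Σ ℕ λ c₁ → Σ ℕ λ c₂ → Σ ℕ λ N → (n : ℕ) → n ≥ N →
    (u n ≤ c₁ * numRealizations n) × (numRealizations n ≤ c₂ * u n)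
mainTheorem10 = 4 , 1 , 1 , bounds
  where
  bounds : (n : ℕ) → n ≥ 1 → (u n ≤ 4 * numRealizations n) × (numRealizations n ≤ 1 * u n)
  bounds (suc k) _ =
    subst (λ N → u (suc k) ≤ 4 * N) (sym (numRealizations-suc k)) (u≤4H k) ,
    subst (_≤ 1 * u (suc k)) (sym (numRealizations-suc k))
          (subst (H k ≤_) (sym (*-identityˡ (u (suc k)))) (H≤u k))
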